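{- For any SDS $K\subseteq\mathcal P(\mathcal T)$: (i) $K$ is consistent if and only if $E(K)=\{D\in\overline{\mathbf D}:K\subseteq K_D\}\neq\emptyset$; (ii) $\mathrm{cl}_{\mathbf K}(K)=\bigcap_{D\in\overline{\mathbf D}:\ K\subseteq K_D}K_D$; (iii) $K$ is coherent if and only if $K$ is consistent and $K=\bigcap_{D\in\overline{\mathbf D}:\ K\subseteq K_D}K_D$.
   Context: Let $\mathcal T$ be a non-empty set (of "things"), $\mathrm{cl}:\mathcal P(\mathcal T)\to\mathcal P(\mathcal T)$ a closure operator (extensive, monotone, idempotent), $\mathcal T_-\subseteq\mathcal T$ a set of forbidden things, $\mathcal T_+:=\mathrm{cl}(\emptyset)$, with standing assumption $\mathcal T_+\cap\mathcal T_-=\emptyset$. A coherent SDT is a $D\subseteq\mathcal T$ with $\mathrm{cl}(D)=D$ and $D\cap\mathcal T_-=\emptyset$; $\overline{\mathbf D}$ is the set of all coherent SDTs. For $\mathcal W\subseteq\mathcal P(\mathcal T)$, $\Sigma_{\mathcal W}$ is the set of maps $\sigma:\mathcal W\to\mathcal T$ with $\sigma(S)\in S$ for all $S\in\mathcal W$, and $\sigma(\mathcal W):=\{\sigma(S):S\in\mathcal W\}$. An SDS is any $K\subseteq\mathcal P(\mathcal T)$. It is coherent if (K1) $\emptyset\notin K$; (K2) if $S_1\in K$ and $S_1\subseteq S_2\subseteq\mathcal T$ then $S_2\in K$; (K3) if $S\in K$ then $S\setminus\mathcal T_-\in K$; (K4) $\{t\}\in K$ for all $t\in\mathcal T_+$;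 (K5) for every non-empty $\mathcal W\subseteq K$ and every family $(t_\sigma)_{\sigma\in\Sigma_{\mathcal W}}$ with $t_\sigma\in\mathrm{cl}(\sigma(\mathcal W))$, $\{t_\sigma:\sigma\in\Sigma_{\mathcal W}\}\in K$. An SDS is consistent if it is included in some coherent SDS. $\mathrm{cl}_{\mathbf K}(K)$ is the intersection of all coherent SDSes including $K$, which is $\mathcal P(\mathcal T)$ if there are none. For $D\subseteq\mathcal T$ let $K_D:=\{S\subseteq\mathcal T:S\cap D\neq\emptyset\}$. For $S\subseteq\mathcal T$ let $\overline{\mathbf D}_S:=\{D\in\overline{\mathbf D}:S\cap D\neq\emptyset\}$ and $E(\mathcal W):=\bigcap_{S\in\mathcal W}\overline{\mathbf D}_S$ (with $E(\emptyset)=\overline{\mathbf D}$). An intersection over an empty family of $K_D$'s is taken to be $\mathcal P(\mathcal T)$. -}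

module Defs where

open import Level using (Level; 0ℓ) renaming (suc to lsuc)
open import Data.Product using (Σ; ∃; _×_; _,_; proj₁)
open import Data.Empty using (⊥)
open import Relation.Nullary using (¬_)
open import Relation.Binary.PropositionalEquality using (_≡_)
open import Relation.Unary using (Pred; _⊆_; _≐_; ∅; ｛_｝; Satisfiable; _∩_; _∖_; Empty)

record Framework : Set₂ where
  field
    T       : Set
    nonempty : T
    cl      : Pred T 0ℓ → Pred T 0ℓ
    cl-ext  : ∀ (S : Pred T 0ℓ) → S ⊆ cl S
    cl-mono : ∀ (S₁ S₂ : Pred T 0ℓ) → S₁ ⊆ S₂ → cl S₁ ⊆ cl S₂
    cl-idem : ∀ (S : Pred T 0ℓ) → cl (cl S) ≐ cl S
    T₋      : Pred T 0ℓ
  T₊ : Pred T 0ℓ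
  T₊ = cl ∅
  field
    T₊∩T₋=∅ : Empty (T₊ ∩ T₋)

module Theory (F : Framework) where
  open Framework F public

  Subset : Set₁
  Subset = Pred T 0ℓ

  SDS : Set₁
  SDS = Pred Subset 0ℓ

  CoherentSDT : Subset → Set
  CoherentSDT D = (cl D ≐ D) × Empty (D ∩ T₋)

  Sel : SDS → Set₁
  Sel W = (S : Subset) → W S → Σ T S

  Image : {W : SDS} → Sel W → Pred T (lsuc 0ℓ)
  Image {W} σ t = Σ Subset λ S → Σ (W S) λ w → proj₁ (σ S w) ≡ t

  K1 K4 : SDS → Set
  K2 K3 K5 : SDS → Set₁
  K1 K = ¬ K ∅
  K2 K = ∀ (S₁ S₂ : Subset) → K S₁ → S₁ ⊆ S₂ → K S₂
  K3 K = ∀ (S : Subset) → K S → K (S ∖ T₋)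
  K4 K = ∀ (t : T) → T₊ t → K ｛ t ｝
  -- For every non-empty 𝒲 ⊆ K and every family (t_σ) with
  -- t_σ ∈ cl(σ(𝒲)), the set {t_σ : σ ∈ Σ_𝒲} belongs to K.
  -- (σ(𝒲) and {t_σ} are large predicates; "t_σ ∈ cl(σ(𝒲))" means
  -- t_σ ∈ cl A for a small subset A equal to σ(𝒲), and "{t_σ} ∈ K"
  -- means every small subset equal to {t_σ} belongs to K.)
  K5 K = ∀ (W : SDS) → Satisfiable W → W ⊆ K →
         (tσ : Sel W → T) →
         (∀ (σ : Sel W) → Σ Subset λ A → (A ≐ Image σ) × cl A (tσ σ)) →
         ∀ (B : Subset) → B ≐ (λ t → ∃ λ (σ : Sel W) → tσ σ ≡ t) → K B

  CoherentSDS : SDS → Set₁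
  CoherentSDS K = K1 K × K2 K × K3 K × K4 K × K5 K

  Consistent : SDS → Set₁
  Consistent K = Σ SDS λ K′ → CoherentSDS K′ × K ⊆ K′

  -- cl_𝐊(K): intersection of all coherent SDSes including K
  -- (everything if there is none).
  clK : SDS → Pred Subset (lsuc 0ℓ)
  clK K S = ∀ (K′ : SDS) → CoherentSDS K′ → K ⊆ K′ → K′ S

  K[_] : Subset → Pred Subset 0ℓ
  K[ D ] S = Satisfiable (S ∩ D)

  Dbar[_] : Subset → Pred Subset 0ℓ
  Dbar[ S ] D = CoherentSDT D × Satisfiable (S ∩ D)

  E : SDS → Pred Subset (lsuc 0ℓ)
  E W D = CoherentSDT D × (∀ (S : Subset) → W S → Satisfiable (S ∩ D))

  ⋂KD : SDS → Pred Subset (lsuc 0ℓ)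
  ⋂KD K S = ∀ (D : Subset) → CoherentSDT D → K ⊆ K[ D ] → K[ D ] S

{-# OPTIONS --safe #-}
module Submission where

-- For a coherent SDT D the SDS K_D is coherent, and coherence is preserved by
-- intersections; this gives cl_K(K) ⊆ ⋂ K_D and the "if" half of (iii).  The
-- converse rests on a separation property: if K is coherent and S ∉ K, some
-- coherent D has K ⊆ K_D and S ∩ D = ∅.  Either a selection σ of K has
-- cl(σ(K)) disjoint from S ∪ 𝒯₋, and D := cl(σ(K)) works, or every σ yields
-- some t_σ ∈ cl(σ(K)) ∩ (S ∪ 𝒯₋); then K5 puts {t_σ} ∈ K, and K2, K3 turn
-- this subset of S ∪ 𝒯₋ into S ∈ K.

open import Defs
open import Level using (Level)
open import Data.Product using (_×_; Σ; _,_; proj₁; proj₂; ∃)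
open import Data.Sum using (inj₁; inj₂)
open import Data.Empty using (⊥-elim)
open import Function.Bundles using (_⇔_; mk⇔; Equivalence)
open import Relation.Unary using (Pred; _⊆_; _≐_; Satisfiable; Empty; _∩_; _∪_; ∅)
open import Relation.Nullary using (¬_; yes; no)
open import Relation.Nullary.Decidable using (True; toWitness; fromWitness)
open import Relation.Binary.PropositionalEquality using (_≡_; refl)
open import Axiom.ExcludedMiddle using (ExcludedMiddle)
open import Axiom.DoubleNegationElimination using (em⇒dne)

module _ (F : Framework) where
  open Theory F

  cl-least : {A D : Subset} → cl D ⊆ D → A ⊆ D → cl A ⊆ D
  cl-least {A} {D} clD⊆D A⊆D t∈clA = clD⊆D (cl-mono A D A⊆D t∈clA)

  cl-coherent : (A : Subset) → Empty (cl A ∩ T₋) → CoherentSDT (cl A)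
  cl-coherent A disjoint = cl-idem A , disjoint

  T₊-coherent : CoherentSDT T₊
  T₊-coherent = cl-coherent ∅ T₊∩T₋=∅

  K[]-K1 : (D : Subset) → K1 K[ D ]
  K[]-K1 D (_ , () , _)

  K[]-K2 : (D : Subset) → K2 K[ D ]
  K[]-K2 D S₁ S₂ (t , s , d) S₁⊆S₂ = t , S₁⊆S₂ s , d

  K[]-K3 : (D : Subset) → Empty (D ∩ T₋) → K3 K[ D ]
  K[]-K3 D disjoint S (t , s , d) = t , (s , λ t₋ → disjoint t (d , t₋)) , d

  K[]-K4 : (D : Subset) → cl D ⊆ D → K4 K[ D ]
  K[]-K4 D clD⊆D t t₊ = t , refl , cl-least clD⊆D (λ ()) t₊

  K[]-K5 : (D : Subset) → cl D ⊆ D → K5 K[ D ]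
  K[]-K5 D clD⊆D W _ W⊆K[D] tσ closure B (_ , B⊇) = tσ σ , B⊇ (σ , refl) , tσ∈D
    where
    σ : Sel W
    σ S w = let (t , s , _) = W⊆K[D] w in t , s
    Image⊆D : Image σ ⊆ D
    Image⊆D (_ , w , refl) = proj₂ (proj₂ (W⊆K[D] w))
    tσ∈D : D (tσ σ)
    tσ∈D = let (A , (A⊆Image , _) , tσ∈clA) = closure σ
           in cl-least clD⊆D (λ a → Image⊆D (A⊆Image a)) tσ∈clA

  K[]-coherent : (D : Subset) → CoherentSDT D → CoherentSDS K[ D ]
  K[]-coherent D (clD≐D , disjoint) =
    K[]-K1 D , K[]-K2 D , K[]-K3 D disjoint , K[]-K4 D (proj₁ clD≐D) , K[]-K5 D (proj₁ clD≐D)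

  ≐⋂-coherent : {I : Set₁} (𝒦 : I → SDS) → (∀ i → CoherentSDS (𝒦 i)) → I →
                (K : SDS) → K ≐ (λ S → ∀ i → 𝒦 i S) → CoherentSDS K
  ≐⋂-coherent 𝒦 coherent i₀ K (K⊆⋂ , ⋂⊆K) = k1 , k2 , k3 , k4 , k5
    where
    k1 : K1 K
    k1 k = proj₁ (coherent i₀) (K⊆⋂ k i₀)
    k2 : K2 K
    k2 S₁ S₂ k S₁⊆S₂ = ⋂⊆K λ i → let (_ , c2 , _) = coherent i in c2 S₁ S₂ (K⊆⋂ k i) S₁⊆S₂
    k3 : K3 K
    k3 S k = ⋂⊆K λ i → let (_ , _ , c3 , _) = coherent i in c3 S (K⊆⋂ k i)
    k4 : K4 K
    k4 t t₊ = ⋂⊆K λ i → let (_ , _ , _ , c4 , _) = coherent i in c4 t t₊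
    k5 : K5 K
    k5 W W≠∅ W⊆K tσ closure B B≐ = ⋂⊆K λ i →
      let (_ , _ , _ , _ , c5) = coherent i in
      c5 W W≠∅ (λ w → K⊆⋂ (W⊆K w) i) tσ closure B B≐

  ≐⋂KD-coherent : (K : SDS) → Satisfiable (E K) → K ≐ ⋂KD K → CoherentSDS K
  ≐⋂KD-coherent K (D₀ , D₀-coherent , K⊆K[D₀]) (K⊆⋂ , ⋂⊆K) =
    ≐⋂-coherent (λ (i : Σ Subset λ D → CoherentSDT D × K ⊆ K[ D ]) → K[ proj₁ i ])
      (λ (D , D-coherent , _) → K[]-coherent D D-coherent)
      (D₀ , D₀-coherent , λ {S} → K⊆K[D₀] S)
      K
      ((λ k (D , D-coherent , K⊆K[D]) → K⊆⋂ k D D-coherent K⊆K[D]) ,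
       λ S∈⋂ → ⋂⊆K λ D D-coherent K⊆K[D] → S∈⋂ (D , D-coherent , K⊆K[D]))

  K2-K3-absorb-forbidden : {K : SDS} → K2 K → K3 K →
                           (B S : Subset) → K B → B ⊆ S ∪ T₋ → K S
  K2-K3-absorb-forbidden k2 k3 B S KB B⊆S∪T₋ =
    k2 _ S (k3 _ (k2 B (S ∪ T₋) KB B⊆S∪T₋)) λ where
      (inj₁ s , _)   → s
      (inj₂ t₋ , ¬t₋) → ⊥-elim (¬t₋ t₋)

  module Classical (em : ∀ {ℓ : Level} → ExcludedMiddle ℓ) where

    -- K5 speaks of σ(𝒲) only through small sets equal to it; excluded middle provides them.
    resize : {ℓ : Level} → Pred T ℓ → Subset
    resize P t = True (em {P = P t})

    resize-≐ : {ℓ : Level} (P : Pred T ℓ) → resize P ≐ P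
    resize-≐ P = toWitness , fromWitness

    selection-meets-cl-image : {W : SDS} (σ : Sel W) → W ⊆ K[ cl (resize (Image σ)) ]
    selection-meets-cl-image {W} σ {S} w =
      let (t , s) = σ S w in t , s , cl-ext _ (fromWitness (S , w , refl))

    K5-select : {K : SDS} → K5 K → (W : SDS) → Satisfiable W → W ⊆ K → (X : Subset) →
                (∀ (σ : Sel W) → Satisfiable (cl (resize (Image σ)) ∩ X)) →
                Σ Subset λ B → K B × B ⊆ X
    K5-select k5 W W≠∅ W⊆K X meets =
      B , k5 W W≠∅ W⊆K tσ closure B (resize-≐ _) , B⊆X
      where
      tσ : Sel W → T
      tσ σ = proj₁ (meets σ)
      closure : ∀ σ → Σ Subset λ A → (A ≐ Image σ) × cl A (tσ σ)
      closure σ = resize (Image σ) , resize-≐ (Image σ) , proj₁ (proj₂ (meets σ))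
      B : Subset
      B = resize λ t → ∃ λ σ → tσ σ ≡ t
      B⊆X : B ⊆ X
      B⊆X b with toWitness b
      ... | σ , refl = proj₂ (proj₂ (meets σ))

    separation : (K : SDS) → CoherentSDS K → (S : Subset) → ¬ K S →
                 Σ Subset λ D → CoherentSDT D × K ⊆ K[ D ] × ¬ K[ D ] S
    separation K (_ , k2 , k3 , k4 , k5) S ¬KS with em {P = Satisfiable K}
    ... | no K=∅ = T₊ , T₊-coherent , (λ k → ⊥-elim (K=∅ (_ , k))) ,
                   λ (t , _ , t₊) → K=∅ (_ , k4 t t₊)
    ... | yes K≠∅ with em {P = Σ (Sel K) λ σ → ¬ Satisfiable (cl (resize (Image σ)) ∩ (S ∪ T₋))}
    ...   | yes (σ , disjoint) =
            cl (resize (Image σ)) ,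
            cl-coherent _ (λ t (c , t₋) → disjoint (t , c , inj₂ t₋)) ,
            selection-meets-cl-image σ ,
            λ (t , s , c) → disjoint (t , c , inj₁ s)
    ...   | no none =
            let (B , KB , B⊆S∪T₋) = K5-select k5 K K≠∅ (λ k → k) (S ∪ T₋)
                                      λ σ → em⇒dne em λ ¬meets → none (σ , ¬meets)
            in ⊥-elim (¬KS (K2-K3-absorb-forbidden k2 k3 B S KB B⊆S∪T₋))

    consistent⇔E-satisfiable : (K : SDS) → Consistent K ⇔ Satisfiable (E K)
    consistent⇔E-satisfiable K = mk⇔ to from
      where
      to : Consistent K → Satisfiable (E K)
      to (K′ , K′-coherent , K⊆K′) =
        let (D , D-coherent , K′⊆K[D] , _) = separation K′ K′-coherent ∅ (proj₁ K′-coherent)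
        in D , D-coherent , λ S k → K′⊆K[D] (K⊆K′ k)
      from : Satisfiable (E K) → Consistent K
      from (D , D-coherent , K⊆K[D]) = K[ D ] , K[]-coherent D D-coherent , λ {S} → K⊆K[D] S

    clK≐⋂KD : (K : SDS) → clK K ≐ ⋂KD K
    clK≐⋂KD K = clK⊆⋂KD , ⋂KD⊆clK
      where
      clK⊆⋂KD : clK K ⊆ ⋂KD K
      clK⊆⋂KD S∈clK D D-coherent = S∈clK K[ D ] (K[]-coherent D D-coherent)
      ⋂KD⊆clK : ⋂KD K ⊆ clK K
      ⋂KD⊆clK {S} S∈⋂ K′ K′-coherent K⊆K′ = em⇒dne em λ ¬K′S →
        let (D , D-coherent , K′⊆K[D] , S∉K[D]) = separation K′ K′-coherent S ¬K′S
        in S∉K[D] (S∈⋂ D D-coherent λ k → K′⊆K[D] (K⊆K′ k))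

    coherent⇔consistent-≐⋂KD : (K : SDS) → CoherentSDS K ⇔ (Consistent K × (K ≐ ⋂KD K))
    coherent⇔consistent-≐⋂KD K = mk⇔ to from
      where
      to : CoherentSDS K → Consistent K × (K ≐ ⋂KD K)
      to K-coherent =
        (K , K-coherent , λ k → k) ,
        (λ k D _ K⊆K[D] → K⊆K[D] k) ,
        λ S∈⋂ → proj₂ (clK≐⋂KD K) S∈⋂ K K-coherent (λ k → k)
      from : Consistent K × (K ≐ ⋂KD K) → CoherentSDS K
      from (consistent , K≐⋂KD) =
        ≐⋂KD-coherent K (Equivalence.to (consistent⇔E-satisfiable K) consistent) K≐⋂KD

theorem9 : (em : ∀ {ℓ : Level} → ExcludedMiddle ℓ) → (F : Framework) →
    let open Theory F in
    (K : SDS) →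
    (Consistent K ⇔ Satisfiable (E K))
    × (clK K ≐ ⋂KD K)
    × (CoherentSDS K ⇔ (Consistent K × (K ≐ ⋂KD K)))
theorem9 em F K =
  consistent⇔E-satisfiable K , clK≐⋂KD K , coherent⇔consistent-≐⋂KD K
  where open Classical F em
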